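{- Let $B=5$, let $\tilde p<0$ be an integer and $\tilde q$ a positive integer with $\tilde q\geqslant 3600\sqrt[3]{|\tilde p|}$ and $2\tilde q>|\tilde p|$. Let $F_2=B^{2}\tilde q^{6}-2B\tilde q^{4}-2B\tilde p\tilde q^{3}-2\tilde q^{2}+2\tilde p\tilde q+\tilde p^{2}-\frac5B-\frac{20}{B^{2}\tilde q^{2}}$. Then there is no integer $t$ with $F_2<t<F_2-\frac{10\tilde p}{B^{2}\tilde q^{3}}$. -}

module Defs where

open import Data.Nat as ℕ using (ℕ; NonZero)
open import Data.Nat.Properties using (m*n≢0; m^n≢0)
open import Data.Integer as ℤ using (ℤ; +_)
open import Data.Rational using (ℚ; _/_; _+_; _-_)

B : ℕ
B = 5

⟦_⟧ : ℤ → ℚ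
⟦ z ⟧ = z / 1

term20 : (q : ℕ) → .{{NonZero q}} → ℚ
term20 q = (+ 20) / (B ℕ.^ 2 ℕ.* q ℕ.^ 2)
  where instance
    _ : NonZero (B ℕ.^ 2 ℕ.* q ℕ.^ 2)
    _ = m*n≢0 (B ℕ.^ 2) (q ℕ.^ 2) {{_}} {{m^n≢0 q 2}}

F₂ : (p : ℤ) (q : ℕ) → .{{NonZero q}} → ℚ
F₂ p q =
  ⟦ + (B ℕ.^ 2 ℕ.* q ℕ.^ 6) ℤ.- + (2 ℕ.* B ℕ.* q ℕ.^ 4)
    ℤ.- (+ (2 ℕ.* B)) ℤ.* p ℤ.* + (q ℕ.^ 3)
    ℤ.- + (2 ℕ.* q ℕ.^ 2) ℤ.+ + 2 ℤ.* p ℤ.* + q ℤ.+ p ℤ.* p ⟧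
  - ((+ 5) / B) - term20 q

term10p : (p : ℤ) (q : ℕ) → .{{NonZero q}} → ℚ
term10p p q = ((+ 10) ℤ.* p) / (B ℕ.^ 2 ℕ.* q ℕ.^ 3)
  where instance
    _ : NonZero (B ℕ.^ 2 ℕ.* q ℕ.^ 3)
    _ = m*n≢0 (B ℕ.^ 2) (q ℕ.^ 3) {{_}} {{m^n≢0 q 3}}

{-# OPTIONS --safe #-}
-- Since 5/B = 1, F₂ = N − 1 − w with N an integer and w = 20/(B²q²) ∈ (0, 1),
-- and the length v = −10p/(B²q³) of the interval is at most w exactly when
-- |p| ≤ 2q.  The interval (F₂, F₂ + v) therefore lies inside (N − 2, N − 1),
-- which contains no integer.
module Submission where

open import Defs
open import Data.Nat as ℕ using (ℕ; NonZero; suc)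
import Data.Nat.Properties as ℕ
open import Data.Nat.Solver using (module +-*-Solver)
open import Data.Integer as ℤ using (ℤ; +_; ∣_∣)
import Data.Integer.Properties as ℤ
open import Data.Integer.Tactic.RingSolver as ℤ-Solver using ()
open import Data.Rational using (ℚ; _<_; _≤_; _+_; _-_; -_; 0ℚ; 1ℚ; toℚᵘ; _/_)
open import Data.Rational.Properties
open import Data.Rational.Unnormalised as ℚᵘ using (mkℚᵘ; *≡*; *≤*; *<*)
import Data.Rational.Unnormalised.Properties as ℚᵘ
open import Data.Product using (∃; _×_; _,_)
open import Relation.Nullary using (¬_)
open import Relation.Binary.PropositionalEquality

toℚᵘ-/ : ∀ a c → toℚᵘ (a / suc c) ℚᵘ.≃ mkℚᵘ a c
toℚᵘ-/ a c = toℚᵘ-fromℚᵘ (mkℚᵘ a c)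

/-mono-≤ : ∀ a b c d → a ℤ.* + suc d ℤ.≤ b ℤ.* + suc c → a / suc c ≤ b / suc d
/-mono-≤ a b c d ad≤bc = toℚᵘ-cancel-≤
  (ℚᵘ.≤-respʳ-≃ (ℚᵘ.≃-sym (toℚᵘ-/ b d)) (ℚᵘ.≤-respˡ-≃ (ℚᵘ.≃-sym (toℚᵘ-/ a c)) (*≤* ad≤bc)))

/-mono-< : ∀ a b c d → a ℤ.* + suc d ℤ.< b ℤ.* + suc c → a / suc c < b / suc d
/-mono-< a b c d ad<bc = toℚᵘ-cancel-<
  (ℚᵘ.<-respʳ-≃ (ℚᵘ.≃-sym (toℚᵘ-/ b d)) (ℚᵘ.<-respˡ-≃ (ℚᵘ.≃-sym (toℚᵘ-/ a c)) (*<* ad<bc)))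

/-cancel-< : ∀ a b c d → a / suc c < b / suc d → a ℤ.* + suc d ℤ.< b ℤ.* + suc c
/-cancel-< a b c d a/c<b/d
  with ℚᵘ.<-respʳ-≃ (toℚᵘ-/ b d) (ℚᵘ.<-respˡ-≃ (toℚᵘ-/ a c) (toℚᵘ-mono-< a/c<b/d))
... | *<* ad<bc = ad<bc

neg-/ : ∀ a c → - (a / suc c) ≡ (ℤ.- a) / suc c
neg-/ a c = toℚᵘ-injective (begin
  toℚᵘ (- (a / suc c))        ≈⟨ toℚᵘ-homo‿- (a / suc c) ⟩
  ℚᵘ.- toℚᵘ (a / suc c)       ≈⟨ ℚᵘ.-‿cong (toℚᵘ-/ a c) ⟩
  mkℚᵘ (ℤ.- a) c              ≈⟨ ℚᵘ.≃-sym (toℚᵘ-/ (ℤ.- a) c) ⟩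
  toℚᵘ ((ℤ.- a) / suc c)      ∎)
  where open ℚᵘ.≃-Reasoning

⟦⟧-homo-− : ∀ a b → ⟦ a ⟧ - ⟦ b ⟧ ≡ ⟦ a ℤ.- b ⟧
⟦⟧-homo-− a b = toℚᵘ-injective (begin
  toℚᵘ (⟦ a ⟧ + - ⟦ b ⟧)              ≈⟨ toℚᵘ-homo-+ ⟦ a ⟧ (- ⟦ b ⟧) ⟩
  toℚᵘ ⟦ a ⟧ ℚᵘ.+ toℚᵘ (- ⟦ b ⟧)      ≈⟨ ℚᵘ.+-cong (toℚᵘ-/ a 0) (ℚᵘ.≃-trans (toℚᵘ-homo‿- ⟦ b ⟧) (ℚᵘ.-‿cong (toℚᵘ-/ b 0))) ⟩
  mkℚᵘ a 0 ℚᵘ.+ mkℚᵘ (ℤ.- b) 0        ≈⟨ *≡* (numerators a b) ⟩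
  mkℚᵘ (a ℤ.- b) 0                    ≈⟨ ℚᵘ.≃-sym (toℚᵘ-/ (a ℤ.- b) 0) ⟩
  toℚᵘ ⟦ a ℤ.- b ⟧                    ∎)
  where
  open ℚᵘ.≃-Reasoning
  numerators : ∀ a b → (a ℤ.* + 1 ℤ.+ (ℤ.- b) ℤ.* + 1) ℤ.* + 1 ≡ (a ℤ.- b) ℤ.* (+ 1 ℤ.* + 1)
  numerators = ℤ-Solver.solve-∀

⟦⟧-cancel-< : ∀ {a b} → ⟦ a ⟧ < ⟦ b ⟧ → a ℤ.< b
⟦⟧-cancel-< {a} {b} ⟦a⟧<⟦b⟧ =
  subst₂ ℤ._<_ (ℤ.*-identityʳ a) (ℤ.*-identityʳ b) (/-cancel-< a b 0 0 ⟦a⟧<⟦b⟧)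

no-integer-between : ∀ M {x y} → ⟦ M ⟧ - 1ℚ ≤ x → y ≤ ⟦ M ⟧ →
  ¬ (∃ λ t → x < ⟦ t ⟧ × ⟦ t ⟧ < y)
no-integer-between M {x} {y} M-1≤x y≤M (t , x<t , t<y) = ℤ.<⇒≱ M-1<t t≤M-1
  where
  M-1<t : M ℤ.- + 1 ℤ.< t
  M-1<t = ⟦⟧-cancel-< {M ℤ.- + 1} (subst (_< ⟦ t ⟧) (⟦⟧-homo-− M (+ 1)) (≤-<-trans M-1≤x x<t))
  t≤M-1 : t ℤ.≤ M ℤ.- + 1
  t≤M-1 = subst (t ℤ.≤_) (ℤ.+-comm ℤ.-1ℤ M) (ℤ.i<j⇒i≤pred[j] (⟦⟧-cancel-< {t} {M} (<-≤-trans t<y y≤M)))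

x-1≤x-w : ∀ x {w} → w ≤ 1ℚ → x - 1ℚ ≤ x - w
x-1≤x-w x w≤1 = +-monoʳ-≤ x (neg-antimono-≤ w≤1)

x-w-v≤x : ∀ x {w v} → - v ≤ w → x - w - v ≤ x
x-w-v≤x x {w} {v} -v≤w = begin
  x - w - v        ≡⟨ +-assoc x (- w) (- v) ⟩
  x + (- w - v)    ≤⟨ +-monoʳ-≤ x (+-monoʳ-≤ (- w) -v≤w) ⟩
  x + (- w + w)    ≡⟨ cong (_+_ x) (+-inverseˡ w) ⟩
  x + 0ℚ           ≡⟨ +-identityʳ x ⟩
  x                ∎
  where open ≤-Reasoning

F₂-polynomial : ℤ → ℕ → ℤ
F₂-polynomial p q = + (B ℕ.^ 2 ℕ.* q ℕ.^ 6) ℤ.- + (2 ℕ.* B ℕ.* q ℕ.^ 4)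
  ℤ.- (+ (2 ℕ.* B)) ℤ.* p ℤ.* + (q ℕ.^ 3)
  ℤ.- + (2 ℕ.* q ℕ.^ 2) ℤ.+ + 2 ℤ.* p ℤ.* + q ℤ.+ p ℤ.* p

F₂-split : ∀ p q .{{_ : NonZero q}} → F₂ p q ≡ ⟦ F₂-polynomial p q ⟧ - 1ℚ - term20 q
F₂-split p q = refl

term20<1 : ∀ k → term20 (suc k) < 1ℚ
term20<1 k = /-mono-< (+ 20) (+ 1) _ 0
  (subst₂ ℤ._<_ (sym (ℤ.*-identityʳ (+ 20))) (sym (ℤ.*-identityˡ _)) (ℤ.+<+ 20<25q²))
  where
  20<25q² : 20 ℕ.< 25 ℕ.* suc k ℕ.^ 2
  20<25q² = ℕ.≤-trans (ℕ.m≤m+n 21 4) (ℕ.*-monoʳ-≤ 25 (ℕ.m^n>0 (suc k) 2))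

-term10p≤term20 : ∀ m k → suc m ℕ.≤ 2 ℕ.* suc k → - term10p ℤ.-[1+ m ] (suc k) ≤ term20 (suc k)
-term10p≤term20 m k 1+m≤2q =
  subst (_≤ term20 q) (sym (neg-/ (+ 10 ℤ.* ℤ.-[1+ m ]) _))
    (/-mono-≤ (+ (10 ℕ.* suc m)) (+ 20) (ℕ.pred (25 ℕ.* q ℕ.^ 3)) (ℕ.pred (25 ℕ.* q ℕ.^ 2))
      (ℤ.+≤+ cross-multiplied))
  where
  q = suc k
  open ℕ.≤-Reasoning
  open +-*-Solver using (solve; _:*_; _:^_; _:=_; con)
  cross-multiplied : 10 ℕ.* suc m ℕ.* (25 ℕ.* q ℕ.^ 2) ℕ.≤ 20 ℕ.* (25 ℕ.* q ℕ.^ 3)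
  cross-multiplied = begin
    10 ℕ.* suc m ℕ.* (25 ℕ.* q ℕ.^ 2)    ≤⟨ ℕ.*-monoˡ-≤ (25 ℕ.* q ℕ.^ 2) (ℕ.*-monoʳ-≤ 10 1+m≤2q) ⟩
    10 ℕ.* (2 ℕ.* q) ℕ.* (25 ℕ.* q ℕ.^ 2) ≡⟨ solve 1 (λ n → con 10 :* (con 2 :* n) :* (con 25 :* n :^ 2)
                                                      := con 20 :* (con 25 :* n :^ 3)) refl q ⟩
    20 ℕ.* (25 ℕ.* q ℕ.^ 3)               ∎

theorem7p7 : (p : ℤ) (q : ℕ) .{{_ : NonZero q}} → p ℤ.< + 0 →
    (3600 ℕ.^ 3) ℕ.* ∣ p ∣ ℕ.≤ q ℕ.^ 3 → ∣ p ∣ ℕ.< 2 ℕ.* q →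
    ¬ (∃ λ (t : ℤ) → (F₂ p q < ⟦ t ⟧) × (⟦ t ⟧ < F₂ p q - term10p p q))
theorem7p7 (+ n) q (ℤ.+<+ ()) _ _
theorem7p7 ℤ.-[1+ m ] ℕ.zero _ _ ()
theorem7p7 p@(ℤ.-[1+ m ]) q@(suc k) _ _ |p|<2q =
  no-integer-between (N ℤ.- + 1) lower upper
  where
  N = F₂-polynomial p q
  open ≤-Reasoning
  ⟦N⟧-1 : ⟦ N ⟧ - 1ℚ ≡ ⟦ N ℤ.- + 1 ⟧
  ⟦N⟧-1 = ⟦⟧-homo-− N (+ 1)
  lower : ⟦ N ℤ.- + 1 ⟧ - 1ℚ ≤ F₂ p q
  lower = begin
    ⟦ N ℤ.- + 1 ⟧ - 1ℚ       ≡⟨ cong (_- 1ℚ) ⟦N⟧-1 ⟨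
    ⟦ N ⟧ - 1ℚ - 1ℚ          ≤⟨ x-1≤x-w (⟦ N ⟧ - 1ℚ) (<⇒≤ (term20<1 k)) ⟩
    ⟦ N ⟧ - 1ℚ - term20 q    ≡⟨ F₂-split p q ⟨
    F₂ p q                   ∎
  upper : F₂ p q - term10p p q ≤ ⟦ N ℤ.- + 1 ⟧
  upper = begin
    F₂ p q - term10p p q                   ≡⟨ cong (_- term10p p q) (F₂-split p q) ⟩
    ⟦ N ⟧ - 1ℚ - term20 q - term10p p q    ≤⟨ x-w-v≤x (⟦ N ⟧ - 1ℚ) (-term10p≤term20 m k (ℕ.<⇒≤ |p|<2q)) ⟩
    ⟦ N ⟧ - 1ℚ                             ≡⟨ ⟦N⟧-1 ⟩
    ⟦ N ℤ.- + 1 ⟧                          ∎
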